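{- Let $R$ be a ring, let $M,N_1,N_2$ be left $R$-modules with $M\subseteq_R N_1$ and $M\subseteq_R N_2$, and let $\bar b_1\in N_1^{<\omega}$, $\bar b_2\in N_2^{<\omega}$. Then $\mathbf{gtp}_{(R\text{ -Mod},\subseteq_R)}(\bar b_1/M;N_1)=\mathbf{gtp}_{(R\text{ -Mod},\subseteq_R)}(\bar b_2/M;N_2)$ if and only if the quantifier-free type of $\bar b_1$ over $M$ in $N_1$ equals the quantifier-free type of $\bar b_2$ over $M$ in $N_2$.
   Context: $(R\text{ -Mod},\subseteq_R)$ is the class of left $R$-modules ordered by the submodule relation $\subseteq_R$, with embeddings (injective homomorphisms) as morphisms. For $M\subseteq_R N$ and a finite tuple $\bar b$ from $N$, the Galois type $\mathbf{gtp}(\bar b/M;N)$ is the equivalence class of $(\bar b,M,N)$ under the transitive closure of the relation: $(\bar b_1,M,N_1)E_{at}(\bar b_2,M,N_2)$ iff there are a left $R$-module $N$ and embeddings $f_\ell:N_\ell\to N$ ($\ell=1,2$) fixing $M$ pointwise with $f_1(\bar b_1)=f_2(\bar b_2)$. Quantifier-free types are taken in the language of left $R$-modules with parameters from $M$. -}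

module Defs where

open import Level using (Level; _⊔_; suc)
open import Data.Nat using (ℕ)
open import Data.Fin using (Fin)
open import Data.Product using (Σ; _×_; _,_)
open import Data.Sum using (_⊎_)
open import Relation.Nullary using (¬_)
open import Function.Bundles using (_⇔_)
open import Algebra.Bundles using (Ring)
open import Algebra.Module.Bundles using (LeftModule)
open import Algebra.Module.Morphism.Structures using (module LeftModuleMorphisms)
open import Relation.Binary.Construct.Closure.Transitive using (TransClosure)

-- Throughout: R is a ring, and the class R-Mod is the class of all left
-- R-modules whose carrier and (setoid) equality live in universe ℓ.
module _ {ℓ ℓr : Level} (R : Ring ℓ ℓr) where

  open Ring R using (Carrier)
  open LeftModule

  record Embedding (N₁ N₂ : LeftModule R ℓ ℓ) : Set ℓ where
    field
      map  : Carrierᴹ N₁ → Carrierᴹ N₂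
      isMono : LeftModuleMorphisms.IsLeftModuleMonomorphism
                 (rawLeftModule N₁) (rawLeftModule N₂) map
  open Embedding public

  -- A triple (b̄, M, N) with M ⊆_R N, where the submodule relation M ⊆_R N
  -- is represented by an embedding ι : M → N, and b̄ is an n-tuple from N.
  record Triple (M : LeftModule R ℓ ℓ) (n : ℕ) : Set (suc ℓ ⊔ ℓr) where
    constructor triple
    field
      Amb : LeftModule R ℓ ℓ
      inc : Embedding M Amb
      tup : Fin n → Carrierᴹ Amb
  open Triple public

  Eat : ∀ {M : LeftModule R ℓ ℓ} {n : ℕ} → Triple M n → Triple M n → Set (suc ℓ ⊔ ℓr)
  Eat {M} {n} T₁ T₂ =
    Σ (LeftModule R ℓ ℓ) λ N →
    Σ (Embedding (Amb T₁) N) λ f₁ →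
    Σ (Embedding (Amb T₂) N) λ f₂ →
      ((m : Carrierᴹ M) → _≈ᴹ_ N (map f₁ (map (inc T₁) m)) (map f₂ (map (inc T₂) m)))
      × ((i : Fin n) → _≈ᴹ_ N (map f₁ (tup T₁ i)) (map f₂ (tup T₂ i)))

  GtpEq : ∀ {M : LeftModule R ℓ ℓ} {n : ℕ} → Triple M n → Triple M n → Set (suc ℓ ⊔ ℓr)
  GtpEq = TransClosure Eat

  data Term (M : LeftModule R ℓ ℓ) (n : ℕ) : Set ℓ where
    var  : Fin n → Term M n
    par  : Carrierᴹ M → Term M n
    zer  : Term M n
    _⊕_  : Term M n → Term M n → Term M n
    ⊖_   : Term M n → Term M n
    _⊙_  : Carrier → Term M n → Term M n

  data QF (M : LeftModule R ℓ ℓ) (n : ℕ) : Set ℓ where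
    _≐_  : Term M n → Term M n → QF M n
    ⊤f   : QF M n
    ⊥f   : QF M n
    ¬f_  : QF M n → QF M n
    _∧f_ : QF M n → QF M n → QF M n
    _∨f_ : QF M n → QF M n → QF M n

  module _ {M : LeftModule R ℓ ℓ} {n : ℕ} (T : Triple M n) where
    private N = Amb T

    eval : Term M n → Carrierᴹ N
    eval (var i) = tup T i
    eval (par m) = map (inc T) m
    eval zer     = 0ᴹ N
    eval (t ⊕ s) = _+ᴹ_ N (eval t) (eval s)
    eval (⊖ t)   = -ᴹ_ N (eval t)
    eval (r ⊙ t) = _*ₗ_ N r (eval t)

    Sat : QF M n → Set ℓ
    Sat (t ≐ s)  = _≈ᴹ_ N (eval t) (eval s)
    Sat ⊤f       = Level.Lift ℓ Data.Unit.⊤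
      where import Data.Unit
    Sat ⊥f       = Level.Lift ℓ Data.Empty.⊥
      where import Data.Empty
    Sat (¬f φ)   = ¬ Sat φ
    Sat (φ ∧f ψ) = Sat φ × Sat ψ
    Sat (φ ∨f ψ) = Sat φ ⊎ Sat ψ

  QftpEq : ∀ {M : LeftModule R ℓ ℓ} {n : ℕ} → Triple M n → Triple M n → Set ℓ
  QftpEq {M} {n} T₁ T₂ = (φ : QF M n) → Sat T₁ φ ⇔ Sat T₂ φ

module Submission where

-- Embeddings preserve and reflect equations t(b̄) = s(b̄) with parameters from M, so the
-- quantifier-free type is invariant under E_at and hence under equality of Galois types.
-- Conversely, if the quantifier-free types agree, then eval₁ t ↦ eval₂ t is a well-defined
-- isomorphism between the submodules generated by M ∪ b̄₁ and by M ∪ b̄₂, and N₁, N₂ are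
-- amalgamated over it: the amalgam is N₁ ⊕ N₂ modulo the antidiagonal {(eval₁ t, −eval₂ t)}.
-- Agreement of the quantifier-free types is exactly what makes the antidiagonal meet N₁ ⊕ 0
-- and 0 ⊕ N₂ trivially, so both canonical maps into the amalgam are embeddings.

open import Level using (Level; _⊔_)
open import Data.Nat using (ℕ)
open import Data.Fin using (Fin)
open import Data.Product using (Σ-syntax; _×_; _,_)
open import Data.Product.Function.NonDependent.Propositional using (_×-⇔_)
open import Data.Sum.Function.Propositional using (_⊎-⇔_)
open import Function.Base using (id; _∘_)
open import Function.Bundles using (_⇔_; mk⇔; module Equivalence)
open import Function.Construct.Identity using (⇔-id)
open import Function.Construct.Symmetry using (⇔-sym)
open import Function.Construct.Composition using (_⇔-∘_)
open import Function.Related.TypeIsomorphisms using (¬-cong-⇔)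
open import Relation.Binary.Core using (Rel)
open import Relation.Binary.Construct.Closure.Transitive using ([_]; _∷_)
open import Algebra.Bundles using (Ring; CommutativeMonoid)
open import Algebra.Module.Bundles using (LeftModule)
open import Algebra.Module.Morphism.Structures using (module LeftModuleMorphisms)
import Algebra.Module.Construct.DirectProduct as DirectProduct
import Algebra.Module.Morphism.Construct.Composition as Composition
import Algebra.Properties.AbelianGroup as AbelianGroupProperties
import Algebra.Properties.CommutativeSemigroup as CommutativeSemigroupProperties
import Relation.Binary.Reasoning.Setoid as SetoidReasoning
open import Defs

open LeftModuleMorphisms using (IsLeftModuleHomomorphism)

module _ {c ℓc : Level} {R : Ring c ℓc} where

  module _ {m ℓm : Level} (N : LeftModule R m ℓm) where
    open LeftModule N
    open AbelianGroupProperties +ᴹ-abelianGroup using (ε⁻¹≈ε; ⁻¹-injective; inverseʳ-unique)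
    open SetoidReasoning ≈ᴹ-setoid

    -ᴹ‿distribʳ-*ₗ : ∀ r x → -ᴹ (r *ₗ x) ≈ᴹ r *ₗ (-ᴹ x)
    -ᴹ‿distribʳ-*ₗ r x = ≈ᴹ-sym (inverseʳ-unique (r *ₗ x) (r *ₗ (-ᴹ x)) (begin
      r *ₗ x +ᴹ r *ₗ (-ᴹ x) ≈⟨ *ₗ-distribˡ r x (-ᴹ x) ⟨
      r *ₗ (x +ᴹ -ᴹ x)      ≈⟨ *ₗ-congˡ (-ᴹ‿inverseʳ x) ⟩
      r *ₗ 0ᴹ               ≈⟨ *ₗ-zeroʳ r ⟩
      0ᴹ                    ∎))

    ≈0ᴹ⇒-ᴹ≈0ᴹ : ∀ {x} → x ≈ᴹ 0ᴹ → -ᴹ x ≈ᴹ 0ᴹ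
    ≈0ᴹ⇒-ᴹ≈0ᴹ x≈0 = ≈ᴹ-trans (-ᴹ‿cong x≈0) ε⁻¹≈ε

    -ᴹ≈0ᴹ⇒≈0ᴹ : ∀ {x} → -ᴹ x ≈ᴹ 0ᴹ → x ≈ᴹ 0ᴹ
    -ᴹ≈0ᴹ⇒≈0ᴹ -x≈0 = ⁻¹-injective (≈ᴹ-trans -x≈0 (≈ᴹ-sym ε⁻¹≈ε))

    0ᴹ≈0ᴹ+κ⇒κ≈0ᴹ : ∀ {κ} → 0ᴹ ≈ᴹ 0ᴹ +ᴹ κ → κ ≈ᴹ 0ᴹ
    0ᴹ≈0ᴹ+κ⇒κ≈0ᴹ {κ} 0≈0+κ = ≈ᴹ-sym (≈ᴹ-trans 0≈0+κ (+ᴹ-identityˡ κ))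

    x≈y+κ∧κ≈0ᴹ⇒x≈y : ∀ {x y κ} → x ≈ᴹ y +ᴹ κ → κ ≈ᴹ 0ᴹ → x ≈ᴹ y
    x≈y+κ∧κ≈0ᴹ⇒x≈y {y = y} x≈y+κ κ≈0 = ≈ᴹ-trans x≈y+κ (≈ᴹ-trans (+ᴹ-congˡ κ≈0) (+ᴹ-identityʳ y))

  module _ {m₁ ℓm₁ m₂ ℓm₂ : Level} (N₁ : LeftModule R m₁ ℓm₁) (N₂ : LeftModule R m₂ ℓm₂) where
    private
      module N₁ = LeftModule N₁
      module N₂ = LeftModule N₂
      module N₁⊕N₂ = LeftModule (DirectProduct.leftModule N₁ N₂)

    inj₁-isLeftModuleHomomorphism :
      IsLeftModuleHomomorphism N₁.rawLeftModule N₁⊕N₂.rawLeftModule (λ x → x , N₂.0ᴹ)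
    inj₁-isLeftModuleHomomorphism = record
      { +ᴹ-isGroupHomomorphism = record
        { isMonoidHomomorphism = record
          { isMagmaHomomorphism = record
            { isRelHomomorphism = record { cong = λ x≈y → x≈y , N₂.≈ᴹ-refl }
            ; homo = λ _ _ → N₁.≈ᴹ-refl , N₂.≈ᴹ-sym (N₂.+ᴹ-identityˡ N₂.0ᴹ) }
          ; ε-homo = N₁.≈ᴹ-refl , N₂.≈ᴹ-refl }
        ; ⁻¹-homo = λ _ → N₁.≈ᴹ-refl , N₂.≈ᴹ-sym (≈0ᴹ⇒-ᴹ≈0ᴹ N₂ N₂.≈ᴹ-refl) }
      ; *ₗ-homo = λ r _ → N₁.≈ᴹ-refl , N₂.≈ᴹ-sym (N₂.*ₗ-zeroʳ r)
      }

    inj₂-isLeftModuleHomomorphism :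
      IsLeftModuleHomomorphism N₂.rawLeftModule N₁⊕N₂.rawLeftModule (λ y → N₁.0ᴹ , y)
    inj₂-isLeftModuleHomomorphism = record
      { +ᴹ-isGroupHomomorphism = record
        { isMonoidHomomorphism = record
          { isMagmaHomomorphism = record
            { isRelHomomorphism = record { cong = λ x≈y → N₁.≈ᴹ-refl , x≈y }
            ; homo = λ _ _ → N₁.≈ᴹ-sym (N₁.+ᴹ-identityˡ N₁.0ᴹ) , N₂.≈ᴹ-refl }
          ; ε-homo = N₁.≈ᴹ-refl , N₂.≈ᴹ-refl }
        ; ⁻¹-homo = λ _ → N₁.≈ᴹ-sym (≈0ᴹ⇒-ᴹ≈0ᴹ N₁ N₁.≈ᴹ-refl) , N₂.≈ᴹ-refl }
      ; *ₗ-homo = λ r _ → N₁.≈ᴹ-sym (N₁.*ₗ-zeroʳ r) , N₂.≈ᴹ-refl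
      }

  record IsSubmodule {m ℓm k : Level} (P : LeftModule R m ℓm) (K : LeftModule.Carrierᴹ P → Set k)
    : Set (c ⊔ m ⊔ k) where
    open LeftModule P
    field
      0ᴹ-closed : K 0ᴹ
      +ᴹ-closed : ∀ {x y} → K x → K y → K (x +ᴹ y)
      -ᴹ-closed : ∀ {x} → K x → K (-ᴹ x)
      *ₗ-closed : ∀ r {x} → K x → K (r *ₗ x)

  module Quotient {m ℓm k : Level} (P : LeftModule R m ℓm)
    {K : LeftModule.Carrierᴹ P → Set k} (K-isSubmodule : IsSubmodule P K) where
    open LeftModule P
    open IsSubmodule K-isSubmodule
    open Ring R using (_≈_)
    open AbelianGroupProperties +ᴹ-abelianGroup using (⁻¹-∙-comm)
    open CommutativeSemigroupProperties
      (CommutativeMonoid.commutativeSemigroup +ᴹ-commutativeMonoid) using (interchange)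
    open SetoidReasoning ≈ᴹ-setoid

    -- x ≋ y encodes x − y ∈ K.
    _≋_ : Rel Carrierᴹ (m ⊔ ℓm ⊔ k)
    x ≋ y = Σ[ κ ∈ Carrierᴹ ] K κ × x ≈ᴹ y +ᴹ κ

    ≈ᴹ⇒≋ : ∀ {x y} → x ≈ᴹ y → x ≋ y
    ≈ᴹ⇒≋ {y = y} x≈y = 0ᴹ , 0ᴹ-closed , ≈ᴹ-trans x≈y (≈ᴹ-sym (+ᴹ-identityʳ y))

    ≋-refl : ∀ {x} → x ≋ x
    ≋-refl = ≈ᴹ⇒≋ ≈ᴹ-refl

    ≋-sym : ∀ {x y} → x ≋ y → y ≋ x
    ≋-sym {x} {y} (κ , κ∈K , x≈y+κ) = -ᴹ κ , -ᴹ-closed κ∈K , (begin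
      y                 ≈⟨ +ᴹ-identityʳ y ⟨
      y +ᴹ 0ᴹ           ≈⟨ +ᴹ-congˡ (-ᴹ‿inverseʳ κ) ⟨
      y +ᴹ (κ +ᴹ -ᴹ κ)  ≈⟨ +ᴹ-assoc y κ (-ᴹ κ) ⟨
      (y +ᴹ κ) +ᴹ -ᴹ κ  ≈⟨ +ᴹ-congʳ x≈y+κ ⟨
      x +ᴹ -ᴹ κ         ∎)

    ≋-trans : ∀ {x y z} → x ≋ y → y ≋ z → x ≋ z
    ≋-trans {x} {y} {z} (κ , κ∈K , x≈y+κ) (λ′ , λ′∈K , y≈z+λ′) =
      λ′ +ᴹ κ , +ᴹ-closed λ′∈K κ∈K , (begin
        x                  ≈⟨ x≈y+κ ⟩
        y +ᴹ κ             ≈⟨ +ᴹ-congʳ y≈z+λ′ ⟩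
        (z +ᴹ λ′) +ᴹ κ     ≈⟨ +ᴹ-assoc z λ′ κ ⟩
        z +ᴹ (λ′ +ᴹ κ)     ∎)

    +ᴹ-cong-≋ : ∀ {x y u v} → x ≋ y → u ≋ v → (x +ᴹ u) ≋ (y +ᴹ v)
    +ᴹ-cong-≋ {x} {y} {u} {v} (κ , κ∈K , x≈y+κ) (λ′ , λ′∈K , u≈v+λ′) =
      κ +ᴹ λ′ , +ᴹ-closed κ∈K λ′∈K , (begin
        x +ᴹ u                   ≈⟨ +ᴹ-cong x≈y+κ u≈v+λ′ ⟩
        (y +ᴹ κ) +ᴹ (v +ᴹ λ′)    ≈⟨ interchange y κ v λ′ ⟩
        (y +ᴹ v) +ᴹ (κ +ᴹ λ′)    ∎)

    -ᴹ-cong-≋ : ∀ {x y} → x ≋ y → (-ᴹ x) ≋ (-ᴹ y)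
    -ᴹ-cong-≋ {y = y} (κ , κ∈K , x≈y+κ) =
      -ᴹ κ , -ᴹ-closed κ∈K , ≈ᴹ-trans (-ᴹ‿cong x≈y+κ) (≈ᴹ-sym (⁻¹-∙-comm y κ))

    *ₗ-cong-≋ : ∀ {r r′ x y} → r ≈ r′ → x ≋ y → (r *ₗ x) ≋ (r′ *ₗ y)
    *ₗ-cong-≋ {r} {r′} {x} {y} r≈r′ (κ , κ∈K , x≈y+κ) = r *ₗ κ , *ₗ-closed r κ∈K , (begin
      r *ₗ x                ≈⟨ *ₗ-congˡ x≈y+κ ⟩
      r *ₗ (y +ᴹ κ)         ≈⟨ *ₗ-distribˡ r y κ ⟩
      r *ₗ y +ᴹ r *ₗ κ      ≈⟨ +ᴹ-congʳ (*ₗ-congʳ r≈r′) ⟩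
      r′ *ₗ y +ᴹ r *ₗ κ     ∎)

    quotient : LeftModule R m (m ⊔ ℓm ⊔ k)
    quotient = record
      { Carrierᴹ = Carrierᴹ ; _≈ᴹ_ = _≋_ ; _+ᴹ_ = _+ᴹ_ ; _*ₗ_ = _*ₗ_ ; 0ᴹ = 0ᴹ ; -ᴹ_ = -ᴹ_
      ; isLeftModule = record
        { isLeftSemimodule = record
          { +ᴹ-isCommutativeMonoid = record
            { isMonoid = record
              { isSemigroup = record
                { isMagma = record
                  { isEquivalence = record { refl = ≋-refl ; sym = ≋-sym ; trans = ≋-trans }
                  ; ∙-cong = +ᴹ-cong-≋ }
                ; assoc = λ x y z → ≈ᴹ⇒≋ (+ᴹ-assoc x y z) }
              ; identity = (λ x → ≈ᴹ⇒≋ (+ᴹ-identityˡ x)) , (λ x → ≈ᴹ⇒≋ (+ᴹ-identityʳ x)) }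
            ; comm = λ x y → ≈ᴹ⇒≋ (+ᴹ-comm x y) }
          ; isPreleftSemimodule = record
            { *ₗ-cong = *ₗ-cong-≋
            ; *ₗ-zeroˡ = λ x → ≈ᴹ⇒≋ (*ₗ-zeroˡ x)
            ; *ₗ-distribʳ = λ x r s → ≈ᴹ⇒≋ (*ₗ-distribʳ x r s)
            ; *ₗ-identityˡ = λ x → ≈ᴹ⇒≋ (*ₗ-identityˡ x)
            ; *ₗ-assoc = λ r s x → ≈ᴹ⇒≋ (*ₗ-assoc r s x)
            ; *ₗ-zeroʳ = λ r → ≈ᴹ⇒≋ (*ₗ-zeroʳ r)
            ; *ₗ-distribˡ = λ r x y → ≈ᴹ⇒≋ (*ₗ-distribˡ r x y) } }
        ; -ᴹ‿cong = -ᴹ-cong-≋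
        ; -ᴹ‿inverse = (λ x → ≈ᴹ⇒≋ (-ᴹ‿inverseˡ x)) , (λ x → ≈ᴹ⇒≋ (-ᴹ‿inverseʳ x)) } }

    projection-isLeftModuleHomomorphism :
      IsLeftModuleHomomorphism rawLeftModule (LeftModule.rawLeftModule quotient) id
    projection-isLeftModuleHomomorphism = record
      { +ᴹ-isGroupHomomorphism = record
        { isMonoidHomomorphism = record
          { isMagmaHomomorphism = record
            { isRelHomomorphism = record { cong = ≈ᴹ⇒≋ }
            ; homo = λ _ _ → ≋-refl }
          ; ε-homo = ≋-refl }
        ; ⁻¹-homo = λ _ → ≋-refl }
      ; *ₗ-homo = λ _ _ → ≋-refl
      }

module _ {ℓ ℓr : Level} {R : Ring ℓ ℓr} where
  open LeftModule using (≈ᴹ-refl; ≈ᴹ-sym; ≈ᴹ-trans)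
  open LeftModuleMorphisms.IsLeftModuleMonomorphism

  _∘ᴱ_ : ∀ {N₁ N₂ N₃ : LeftModule R ℓ ℓ} → Embedding R N₂ N₃ → Embedding R N₁ N₂ → Embedding R N₁ N₃
  _∘ᴱ_ {N₃ = N₃} g f = record
    { map = map g ∘ map f
    ; isMono = Composition.isLeftModuleMonomorphism (≈ᴹ-trans N₃) (isMono f) (isMono g)
    }

  module _ {M : LeftModule R ℓ ℓ} {n : ℕ} where

    image : (T : Triple R M n) {N : LeftModule R ℓ ℓ} → Embedding R (Amb T) N → Triple R M n
    image T {N} f = triple N (f ∘ᴱ inc T) (map f ∘ tup T)

    map-eval : (T : Triple R M n) {N : LeftModule R ℓ ℓ} (f : Embedding R (Amb T) N) →
      ∀ t → LeftModule._≈ᴹ_ N (map f (eval R T t)) (eval R (image T f) t)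
    map-eval T {N} f (var i) = ≈ᴹ-refl N
    map-eval T {N} f (par m) = ≈ᴹ-refl N
    map-eval T {N} f zer     = 0ᴹ-homo (isMono f)
    map-eval T {N} f (t ⊕ s) =
      ≈ᴹ-trans N (+ᴹ-homo (isMono f) _ _) (LeftModule.+ᴹ-cong N (map-eval T f t) (map-eval T f s))
    map-eval T {N} f (⊖ t)   =
      ≈ᴹ-trans N (-ᴹ-homo (isMono f) _) (LeftModule.-ᴹ‿cong N (map-eval T f t))
    map-eval T {N} f (r ⊙ t) =
      ≈ᴹ-trans N (*ₗ-homo (isMono f) r _) (LeftModule.*ₗ-congˡ N (map-eval T f t))

    QftpEq-sym : {T₁ T₂ : Triple R M n} → QftpEq R T₁ T₂ → QftpEq R T₂ T₁
    QftpEq-sym T₁≡T₂ φ = ⇔-sym (T₁≡T₂ φ)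

    QftpEq-trans : {T₁ T₂ T₃ : Triple R M n} → QftpEq R T₁ T₂ → QftpEq R T₂ T₃ → QftpEq R T₁ T₃
    QftpEq-trans T₁≡T₂ T₂≡T₃ φ = T₂≡T₃ φ ⇔-∘ T₁≡T₂ φ

    atomic⇒QftpEq : {T₁ T₂ : Triple R M n} →
      (∀ t s → Sat R T₁ (t ≐ s) ⇔ Sat R T₂ (t ≐ s)) → QftpEq R T₁ T₂
    atomic⇒QftpEq atomic (t ≐ s)  = atomic t s
    atomic⇒QftpEq atomic ⊤f       = ⇔-id _
    atomic⇒QftpEq atomic ⊥f       = ⇔-id _
    atomic⇒QftpEq atomic (¬f φ)   = ¬-cong-⇔ (atomic⇒QftpEq atomic φ)
    atomic⇒QftpEq atomic (φ ∧f ψ) = atomic⇒QftpEq atomic φ ×-⇔ atomic⇒QftpEq atomic ψ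
    atomic⇒QftpEq atomic (φ ∨f ψ) = atomic⇒QftpEq atomic φ ⊎-⇔ atomic⇒QftpEq atomic ψ

    QftpEq-image : (T : Triple R M n) {N : LeftModule R ℓ ℓ} (f : Embedding R (Amb T) N) →
      QftpEq R T (image T f)
    QftpEq-image T {N} f = atomic⇒QftpEq λ t s → mk⇔
      (λ t≈s → ≈ᴹ-trans N (≈ᴹ-sym N (map-eval T f t))
        (≈ᴹ-trans N (⟦⟧-cong (isMono f) t≈s) (map-eval T f s)))
      (λ ft≈fs → injective (isMono f)
        (≈ᴹ-trans N (map-eval T f t) (≈ᴹ-trans N ft≈fs (≈ᴹ-sym N (map-eval T f s)))))

    module _ {N : LeftModule R ℓ ℓ} {ι ι′ : Embedding R M N} {b b′ : Fin n → LeftModule.Carrierᴹ N}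
      (ι≈ι′ : ∀ m → LeftModule._≈ᴹ_ N (map ι m) (map ι′ m))
      (b≈b′ : ∀ i → LeftModule._≈ᴹ_ N (b i) (b′ i))
      where
      open LeftModule N using (_≈ᴹ_; +ᴹ-cong; -ᴹ‿cong; *ₗ-congˡ)

      eval-cong : ∀ t → eval R (triple N ι b) t ≈ᴹ eval R (triple N ι′ b′) t
      eval-cong (var i) = b≈b′ i
      eval-cong (par m) = ι≈ι′ m
      eval-cong zer     = ≈ᴹ-refl N
      eval-cong (t ⊕ s) = +ᴹ-cong (eval-cong t) (eval-cong s)
      eval-cong (⊖ t)   = -ᴹ‿cong (eval-cong t)
      eval-cong (r ⊙ t) = *ₗ-congˡ (eval-cong t)

      QftpEq-cong : QftpEq R (triple N ι b) (triple N ι′ b′)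
      QftpEq-cong = atomic⇒QftpEq λ t s → mk⇔
        (λ t≈s → ≈ᴹ-trans N (≈ᴹ-sym N (eval-cong t)) (≈ᴹ-trans N t≈s (eval-cong s)))
        (λ t≈s → ≈ᴹ-trans N (eval-cong t) (≈ᴹ-trans N t≈s (≈ᴹ-sym N (eval-cong s))))

    Eat⇒QftpEq : {T₁ T₂ : Triple R M n} → Eat R T₁ T₂ → QftpEq R T₁ T₂
    Eat⇒QftpEq {T₁} {T₂} (N , f₁ , f₂ , f₁≈f₂-on-M , f₁b₁≈f₂b₂) =
      QftpEq-trans (QftpEq-image T₁ f₁)
        (QftpEq-trans (QftpEq-cong f₁≈f₂-on-M f₁b₁≈f₂b₂) (QftpEq-sym (QftpEq-image T₂ f₂)))

    GtpEq⇒QftpEq : {T₁ T₂ : Triple R M n} → GtpEq R T₁ T₂ → QftpEq R T₁ T₂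
    GtpEq⇒QftpEq [ T₁∼T₂ ]       = Eat⇒QftpEq T₁∼T₂
    GtpEq⇒QftpEq (T₁∼T₂ ∷ T₂∼T₃) = QftpEq-trans (Eat⇒QftpEq T₁∼T₂) (GtpEq⇒QftpEq T₂∼T₃)

  module Amalgamation {M : LeftModule R ℓ ℓ} {n : ℕ} (T₁ T₂ : Triple R M n) where
    private
      N₁ = Amb T₁
      N₂ = Amb T₂
      module N₁ = LeftModule N₁
      module N₂ = LeftModule N₂
      open AbelianGroupProperties N₂.+ᴹ-abelianGroup using (ε⁻¹≈ε; ⁻¹-∙-comm)
      e₁ = eval R T₁
      e₂ = eval R T₂

    AntiDiagonal : N₁.Carrierᴹ × N₂.Carrierᴹ → Set ℓ
    AntiDiagonal (u , v) = Σ[ t ∈ Term R M n ] u N₁.≈ᴹ e₁ t × v N₂.≈ᴹ N₂.-ᴹ e₂ t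

    antiDiagonal-isSubmodule : IsSubmodule (DirectProduct.leftModule N₁ N₂) AntiDiagonal
    antiDiagonal-isSubmodule = record
      { 0ᴹ-closed = zer , N₁.≈ᴹ-refl , N₂.≈ᴹ-sym ε⁻¹≈ε
      ; +ᴹ-closed = λ (t , u≈e₁t , v≈-e₂t) (s , u′≈e₁s , v′≈-e₂s) →
          t ⊕ s , N₁.+ᴹ-cong u≈e₁t u′≈e₁s
                , N₂.≈ᴹ-trans (N₂.+ᴹ-cong v≈-e₂t v′≈-e₂s) (⁻¹-∙-comm (e₂ t) (e₂ s))
      ; -ᴹ-closed = λ (t , u≈e₁t , v≈-e₂t) → ⊖ t , N₁.-ᴹ‿cong u≈e₁t , N₂.-ᴹ‿cong v≈-e₂t
      ; *ₗ-closed = λ r (t , u≈e₁t , v≈-e₂t) →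
          r ⊙ t , N₁.*ₗ-congˡ u≈e₁t
                , N₂.≈ᴹ-trans (N₂.*ₗ-congˡ v≈-e₂t) (N₂.≈ᴹ-sym (-ᴹ‿distribʳ-*ₗ N₂ r (e₂ t)))
      }

    open Quotient (DirectProduct.leftModule N₁ N₂) antiDiagonal-isSubmodule
      using (_≋_; ≋-trans; projection-isLeftModuleHomomorphism)
      renaming (quotient to amalgam)

    glue : ∀ t → (e₁ t , N₂.0ᴹ) ≋ (N₁.0ᴹ , e₂ t)
    glue t = (e₁ t , N₂.-ᴹ e₂ t) , (t , N₁.≈ᴹ-refl , N₂.≈ᴹ-refl)
           , N₁.≈ᴹ-sym (N₁.+ᴹ-identityˡ (e₁ t)) , N₂.≈ᴹ-sym (N₂.-ᴹ‿inverseʳ (e₂ t))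

    module _ (T₁≡T₂ : QftpEq R T₁ T₂) where
      open Equivalence using (to; from)

      antiDiagonal⇒≈0ᴹ₁ : ∀ {u v} → AntiDiagonal (u , v) → v N₂.≈ᴹ N₂.0ᴹ → u N₁.≈ᴹ N₁.0ᴹ
      antiDiagonal⇒≈0ᴹ₁ (t , u≈e₁t , v≈-e₂t) v≈0 = N₁.≈ᴹ-trans u≈e₁t
        (from (T₁≡T₂ (t ≐ zer)) (-ᴹ≈0ᴹ⇒≈0ᴹ N₂ (N₂.≈ᴹ-trans (N₂.≈ᴹ-sym v≈-e₂t) v≈0)))

      antiDiagonal⇒≈0ᴹ₂ : ∀ {u v} → AntiDiagonal (u , v) → u N₁.≈ᴹ N₁.0ᴹ → v N₂.≈ᴹ N₂.0ᴹ
      antiDiagonal⇒≈0ᴹ₂ (t , u≈e₁t , v≈-e₂t) u≈0 = N₂.≈ᴹ-trans v≈-e₂t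
        (≈0ᴹ⇒-ᴹ≈0ᴹ N₂ (to (T₁≡T₂ (t ≐ zer)) (N₁.≈ᴹ-trans (N₁.≈ᴹ-sym u≈e₁t) u≈0)))

      inj₁ᴱ : Embedding R N₁ amalgam
      inj₁ᴱ = record
        { map = λ x → x , N₂.0ᴹ
        ; isMono = record
          { isLeftModuleHomomorphism = Composition.isLeftModuleHomomorphism ≋-trans
              (inj₁-isLeftModuleHomomorphism N₁ N₂) projection-isLeftModuleHomomorphism
          ; injective = λ ((u , v) , uv∈K , x≈y+u , 0≈0+v) →
              x≈y+κ∧κ≈0ᴹ⇒x≈y N₁ x≈y+u (antiDiagonal⇒≈0ᴹ₁ uv∈K (0ᴹ≈0ᴹ+κ⇒κ≈0ᴹ N₂ 0≈0+v))
          }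
        }

      inj₂ᴱ : Embedding R N₂ amalgam
      inj₂ᴱ = record
        { map = λ y → N₁.0ᴹ , y
        ; isMono = record
          { isLeftModuleHomomorphism = Composition.isLeftModuleHomomorphism ≋-trans
              (inj₂-isLeftModuleHomomorphism N₁ N₂) projection-isLeftModuleHomomorphism
          ; injective = λ ((u , v) , uv∈K , 0≈0+u , x≈y+v) →
              x≈y+κ∧κ≈0ᴹ⇒x≈y N₂ x≈y+v (antiDiagonal⇒≈0ᴹ₂ uv∈K (0ᴹ≈0ᴹ+κ⇒κ≈0ᴹ N₁ 0≈0+u))
          }
        }

      QftpEq⇒Eat : Eat R T₁ T₂
      QftpEq⇒Eat = amalgam , inj₁ᴱ , inj₂ᴱ , (λ m → glue (par m)) , (λ i → glue (var i))

lemma3p2 : {ℓ ℓr : Level} (R : Ring ℓ ℓr) (M N₁ N₂ : LeftModule R ℓ ℓ)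
    (ι₁ : Embedding R M N₁) (ι₂ : Embedding R M N₂) (n : ℕ)
    (b₁ : Fin n → LeftModule.Carrierᴹ N₁) (b₂ : Fin n → LeftModule.Carrierᴹ N₂) →
    GtpEq R (triple N₁ ι₁ b₁) (triple N₂ ι₂ b₂) ⇔ QftpEq R (triple N₁ ι₁ b₁) (triple N₂ ι₂ b₂)
lemma3p2 R M N₁ N₂ ι₁ ι₂ n b₁ b₂ =
  mk⇔ GtpEq⇒QftpEq (λ qftp≡ → [ Amalgamation.QftpEq⇒Eat (triple N₁ ι₁ b₁) (triple N₂ ι₂ b₂) qftp≡ ])
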